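{- Let $r$ and $s$ be positive integers, both odd. Then there exist permutations of the integers that avoid $(r^{4},r^{3}s,r^{2}s^{2},rs^{3},s^{4})$ $6$-progressions.
   Context: A permutation of $\mathbb{Z}$ is a sequence $p_1,p_2,\dots$ in which every integer appears exactly once. For positive integers $r_1,\dots,r_5$, an $(r_1,\dots,r_5)$ $6$-progression is a sequence $a, a+r_1d, a+(r_1+r_2)d,\dots,a+(r_1+\dots+r_5)d$ of integers with $d\neq0$. A permutation contains one if there are indices $i_1<\dots<i_6$ such that $p_{i_1},\dots,p_{i_6}$ is such a progression. It avoids these progressions otherwise. -}

module Defs where

open import Data.Nat as ℕ using (ℕ; _<_; _^_)
open import Data.Integer as ℤ using (ℤ; +_; _-_; _*_)
open import Data.Product using (Σ; _×_; ∃; ∃-syntax; _,_)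
open import Relation.Binary.PropositionalEquality using (_≡_)
open import Relation.Nullary using (¬_)

-- A permutation of ℤ: a sequence p₁,p₂,… (indexed here from 0) in which
-- every integer appears exactly once, i.e. a bijection ℕ → ℤ.
record PermutationOfℤ : Set where
  field
    seq        : ℕ → ℤ
    injective  : ∀ i j → seq i ≡ seq j → i ≡ j
    surjective : ∀ (z : ℤ) → ∃[ i ] seq i ≡ z
open PermutationOfℤ public

-- An (r₁,…,r₅) 6-progression: a, a+r₁d, a+(r₁+r₂)d, …, with d ≠ 0.
-- Equivalently consecutive differences are r_k·d.
Is6Progression : (r₁ r₂ r₃ r₄ r₅ : ℕ) (x₁ x₂ x₃ x₄ x₅ x₆ : ℤ) → Set
Is6Progression r₁ r₂ r₃ r₄ r₅ x₁ x₂ x₃ x₄ x₅ x₆ =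
  ∃[ d ] (¬ d ≡ + 0
         × x₂ - x₁ ≡ + r₁ * d
         × x₃ - x₂ ≡ + r₂ * d
         × x₄ - x₃ ≡ + r₃ * d
         × x₅ - x₄ ≡ + r₄ * d
         × x₆ - x₅ ≡ + r₅ * d)

Contains : (p : PermutationOfℤ) (r₁ r₂ r₃ r₄ r₅ : ℕ) → Set
Contains p r₁ r₂ r₃ r₄ r₅ =
  ∃[ i₁ ] ∃[ i₂ ] ∃[ i₃ ] ∃[ i₄ ] ∃[ i₅ ] ∃[ i₆ ]
    (i₁ < i₂ × i₂ < i₃ × i₃ < i₄ × i₄ < i₅ × i₅ < i₆
    × Is6Progression r₁ r₂ r₃ r₄ r₅
        (seq p i₁) (seq p i₂) (seq p i₃) (seq p i₄) (seq p i₅) (seq p i₆))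

Avoids : (p : PermutationOfℤ) (r₁ r₂ r₃ r₄ r₅ : ℕ) → Set
Avoids p r₁ r₂ r₃ r₄ r₅ = ¬ Contains p r₁ r₂ r₃ r₄ r₅

module Submission where

-- Only the oddness of the five ratios matters.  Write ν(z) for the 2-adic valuation.
-- If every ratio Rᵢ is odd, all five steps xᵢ₊₁ - xᵢ = Rᵢ·d of a progression have
-- the same valuation ν(d).  Call a finite list F step-free if there are no positions
-- p < q < u with ν(F q - F p) = ν(F u - F q).
--
-- Doubling a list F (the list 2F followed by the list 2F+1) preserves step-freeness,
-- since equal-valuation steps either stay inside one half (and halve to a pair of
-- equal-valuation steps of F) or cross between halves (and are odd).  Iterating from
-- [0, -1] lists the box [-2^a, 2^a); iterating from the box of exponent g with 0 and
-- -1 removed lists the annulus [-2^(a+g), 2^(a+g)) ∖ [-2^a, 2^a).  The permutation is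
-- the concatenation of a box and annuli of exponent g, each block step-free.
--
-- In a progression x₁,…,x₆ step-freeness puts x₁, x₃, x₅ (and x₂, x₄, x₆) into strictly
-- increasing blocks, so |x₅| ≥ 2^g|x₁| and |x₆| ≥ 2^g|x₂|; with |d| ≤ |x₁| + |x₂| and
-- |x₅| ≤ |x₁| + (R₁+…+R₄)|d| this forces d = 0 once 2^g > 2(R₁+…+R₅) + 1.

open import Defs
open import Data.Nat using (ℕ; _^_; _*_; _%_; NonZero)
open import Data.Product using (∃-syntax)
open import Relation.Binary.PropositionalEquality using (_≡_)

open import Data.Nat as N using (zero; suc; z≤n; s≤s; _+_; _∸_; _≤_; _<_; _<?_)
import Data.Nat.Properties as NP
import Data.Nat.DivMod as NDM
open import Data.Nat.Tactic.RingSolver using () renaming (solve-∀ to ℕ-solve)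
open import Data.Integer using (ℤ; +_; -[1+_]; +0; 1ℤ; ∣_∣)
  renaming (_+_ to _+ℤ_; _*_ to _*ℤ_; _-_ to _-ℤ_)
import Data.Integer.Properties as ZP
open import Data.Integer.Tactic.RingSolver using (solve-∀)
open import Data.Product using (_×_; ∃; _,_; proj₁; proj₂)
open import Data.Sum using (_⊎_; inj₁; inj₂)
open import Data.Empty using (⊥; ⊥-elim)
open import Relation.Nullary using (¬_; Dec; yes; no)
open import Relation.Binary.PropositionalEquality
  using (refl; sym; trans; cong; cong₂; subst; subst₂; module ≡-Reasoning)

-- A record rather than a bare equation, so that n can be inferred from Odd n.
record Odd (n : ℕ) : Set where
  constructor odd
  field
    mod2≡1 : n % 2 ≡ 1

odd-* : ∀ {a b} → Odd a → Odd b → Odd (a * b)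
odd-* {a} {b} (odd ha) (odd hb) = odd (begin
    (a * b) % 2              ≡⟨ NDM.%-distribˡ-* a b 2 ⟩
    ((a % 2) * (b % 2)) % 2  ≡⟨ cong₂ (λ x y → (x * y) % 2) ha hb ⟩
    1                        ∎)
  where open ≡-Reasoning

odd-^ : ∀ {a} n → Odd a → Odd (a ^ n)
odd-^ zero    _  = odd refl
odd-^ (suc n) ha = odd-* ha (odd-^ n ha)

odd-form : ∀ {r} → Odd r → ∃ λ k → r ≡ suc (k + k)
odd-form {r} (odd hr) = r N./ 2 , (begin
    r                          ≡⟨ NDM.m≡m%n+[m/n]*n r 2 ⟩
    r % 2 + (r N./ 2) * 2      ≡⟨ cong (_+ (r N./ 2) * 2) hr ⟩
    suc ((r N./ 2) * 2)        ≡⟨ cong suc (times-two (r N./ 2)) ⟩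
    suc (r N./ 2 + r N./ 2)    ∎)
  where
  open ≡-Reasoning
  times-two : ∀ q → q * 2 ≡ q + q
  times-two = ℕ-solve

odd-≤-* : ∀ {R} → Odd R → ∀ m → m ≤ R * m
odd-≤-* {R} hR m with odd-form {R} hR
... | k , refl = NP.m≤n*m m (suc (k + k))

-- They are defined by cases on the sign so that their effect on magnitudes is
-- visible to the interval lemmas below.

dbl : ℤ → ℤ
dbl (+ n)    = + (n + n)
dbl -[1+ n ] = -[1+ suc (n + n) ]

dbl+1 : ℤ → ℤ
dbl+1 (+ n)    = + suc (n + n)
dbl+1 -[1+ n ] = -[1+ (n + n) ]

two : ℤ
two = + 2

dbl≡ : ∀ y → dbl y ≡ two *ℤ y
dbl≡ (+ n)    = trans (cong (λ m → + (n + m)) (sym (NP.+-identityʳ n))) (ZP.pos-* 2 n)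
dbl≡ -[1+ n ] = cong -[1+_] (trans (cong suc (cong (λ m → n + m) (sym (NP.+-identityʳ n))))
                                   (sym (NP.+-suc n (n + 0))))

dbl+1≡ : ∀ y → dbl+1 y ≡ 1ℤ +ℤ two *ℤ y
dbl+1≡ y = trans (one-more y) (cong (1ℤ +ℤ_) (dbl≡ y))
  where
  one-more : ∀ y → dbl+1 y ≡ 1ℤ +ℤ dbl y
  one-more (+ n)    = refl
  one-more -[1+ n ] = refl

halve-ℕ : ∀ n → ∃ λ m → (n ≡ m + m) ⊎ (n ≡ suc (m + m))
halve-ℕ zero = 0 , inj₁ refl
halve-ℕ (suc n) with halve-ℕ n
... | m , inj₁ e = m , inj₂ (cong suc e)
... | m , inj₂ e = suc m , inj₁ (trans (cong suc e) (cong suc (sym (NP.+-suc m m))))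

halve : ∀ x → ∃ λ y → (x ≡ dbl y) ⊎ (x ≡ dbl+1 y)
halve (+ n) with halve-ℕ n
... | m , inj₁ e = + m , inj₁ (cong +_ e)
... | m , inj₂ e = + m , inj₂ (cong +_ e)
halve -[1+ n ] with halve-ℕ n
... | m , inj₁ e = -[1+ m ] , inj₂ (cong -[1+_] e)
... | m , inj₂ e = -[1+ m ] , inj₁ (cong -[1+_] e)

even≢odd : ∀ a b → two *ℤ a ≡ 1ℤ +ℤ two *ℤ b → ⊥
even≢odd a b eq = two*m≢1 ∣ a -ℤ b ∣ (trans (sym (ZP.abs-* two (a -ℤ b))) (cong ∣_∣ twice-diff))
  where
  two*m≢1 : ∀ m → 2 * m ≡ 1 → ⊥
  two*m≢1 zero          ()
  two*m≢1 (suc zero)    ()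
  two*m≢1 (suc (suc m)) ()
  distrib : ∀ a b → two *ℤ (a -ℤ b) ≡ two *ℤ a -ℤ two *ℤ b
  distrib = solve-∀
  cancel : ∀ b → (1ℤ +ℤ two *ℤ b) -ℤ two *ℤ b ≡ 1ℤ
  cancel = solve-∀
  twice-diff : two *ℤ (a -ℤ b) ≡ 1ℤ
  twice-diff = trans (distrib a b) (trans (cong (_-ℤ two *ℤ b) eq) (cancel b))

dbl-injective : ∀ {a b} → dbl a ≡ dbl b → a ≡ b
dbl-injective {a} {b} e = ZP.*-cancelˡ-≡ two a b (trans (sym (dbl≡ a)) (trans e (dbl≡ b)))

dbl+1-injective : ∀ {a b} → dbl+1 a ≡ dbl+1 b → a ≡ b
dbl+1-injective {a} {b} e = ZP.*-cancelˡ-≡ two a b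
    (trans (sym (drop-one a)) (trans (cong (_-ℤ 1ℤ) odd-eq) (drop-one b)))
  where
  odd-eq : 1ℤ +ℤ two *ℤ a ≡ 1ℤ +ℤ two *ℤ b
  odd-eq = trans (sym (dbl+1≡ a)) (trans e (dbl+1≡ b))
  drop-one : ∀ a → (1ℤ +ℤ two *ℤ a) -ℤ 1ℤ ≡ two *ℤ a
  drop-one = solve-∀

dbl≢dbl+1 : ∀ {a b} → dbl a ≡ dbl+1 b → ⊥
dbl≢dbl+1 {a} {b} e = even≢odd a b (trans (sym (dbl≡ a)) (trans e (dbl+1≡ b)))

∣dbl∣ : ∀ y → ∣ dbl y ∣ ≡ ∣ y ∣ + ∣ y ∣
∣dbl∣ (+ n)    = refl
∣dbl∣ -[1+ n ] = cong suc (sym (NP.+-suc n n))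

-- The 2-adic valuation

record Val (t : ℕ) (z : ℤ) : Set where
  constructor mkVal
  field
    oddPart : ℤ
    decomp  : z ≡ + (2 ^ t) *ℤ (1ℤ +ℤ two *ℤ oddPart)

2^suc-* : ∀ t (X : ℤ) → + (2 ^ suc t) *ℤ X ≡ two *ℤ (+ (2 ^ t) *ℤ X)
2^suc-* t X = trans (cong (_*ℤ X) (ZP.pos-* 2 (2 ^ t))) (ZP.*-assoc two (+ (2 ^ t)) X)

even-not-val0 : ∀ {w} → ¬ Val 0 (two *ℤ w)
even-not-val0 {w} (mkVal o eq) = even≢odd w o (trans eq (ZP.*-identityˡ _))

even-val-suc : ∀ {t w} → Val (suc t) (two *ℤ w) → Val t w
even-val-suc {t} {w} (mkVal o eq) = mkVal o (ZP.*-cancelˡ-≡ two w _ (trans eq (2^suc-* t _)))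

odd-not-val-suc : ∀ {t w} → ¬ Val (suc t) (1ℤ +ℤ two *ℤ w)
odd-not-val-suc {t} {w} (mkVal o eq) = even≢odd _ w (sym (trans eq (2^suc-* t _)))

-- Every nonzero integer has a valuation: halve while even (fuel bounds |d|).
val-exists : ∀ d → ¬ d ≡ +0 → ∃ λ t → Val t d
val-exists d = go ∣ d ∣ d NP.≤-refl
  where
  go : ∀ fuel d → ∣ d ∣ ≤ fuel → ¬ d ≡ +0 → ∃ λ t → Val t d
  go fuel d le nz with halve d
  ... | y , inj₂ e = 0 , mkVal y (trans e (trans (dbl+1≡ y) (sym (ZP.*-identityˡ _))))
  go zero d le nz | y , inj₁ e = ⊥-elim (nz (ZP.∣i∣≡0⇒i≡0 (NP.n≤0⇒n≡0 le)))
  go (suc fuel) d le nz | y , inj₁ e with go fuel y ∣y∣≤fuel y≢0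
    where
    y≢0 : ¬ y ≡ +0
    y≢0 refl = nz e
    ∣y∣<∣d∣ : ∣ y ∣ < ∣ d ∣
    ∣y∣<∣d∣ = subst (∣ y ∣ <_) (sym (trans (cong ∣_∣ e) (∣dbl∣ y)))
                (NP.m<m+n ∣ y ∣ (NP.n≢0⇒n>0 (λ z → y≢0 (ZP.∣i∣≡0⇒i≡0 z))))
    ∣y∣≤fuel : ∣ y ∣ ≤ fuel
    ∣y∣≤fuel = NP.≤-pred (NP.≤-trans ∣y∣<∣d∣ le)
  ... | t , mkVal o eq =
    suc t , mkVal o (trans e (trans (dbl≡ y) (trans (cong (two *ℤ_) eq) (sym (2^suc-* t _)))))

val-odd-* : ∀ {t d R} → Odd R → Val t d → Val t (+ R *ℤ d)
val-odd-* {t} {d} {R} hR (mkVal o eq) with odd-form {R} hR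
... | k , refl = mkVal (+ k +ℤ o +ℤ two *ℤ (+ k *ℤ o)) (begin
    + suc (k + k) *ℤ d
      ≡⟨ cong₂ _*ℤ_ (dbl+1≡ (+ k)) eq ⟩
    (1ℤ +ℤ two *ℤ + k) *ℤ (+ (2 ^ t) *ℤ (1ℤ +ℤ two *ℤ o))
      ≡⟨ product-of-odds (+ k) o (+ (2 ^ t)) ⟩
    + (2 ^ t) *ℤ (1ℤ +ℤ two *ℤ (+ k +ℤ o +ℤ two *ℤ (+ k *ℤ o))) ∎)
  where
  open ≡-Reasoning
  product-of-odds : ∀ K o P → (1ℤ +ℤ two *ℤ K) *ℤ (P *ℤ (1ℤ +ℤ two *ℤ o))
                            ≡ P *ℤ (1ℤ +ℤ two *ℤ (K +ℤ o +ℤ two *ℤ (K *ℤ o)))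
  product-of-odds = solve-∀

-- Steps between two values of the same doubling map are twice the step of the
-- preimages: their valuation is positive and drops by one under halving.
DoublesSteps : (ℤ → ℤ) → Set
DoublesSteps D = ∀ a b → D a -ℤ D b ≡ two *ℤ (a -ℤ b)

dbl-doubles : DoublesSteps dbl
dbl-doubles a b rewrite dbl≡ a | dbl≡ b = distrib a b
  where
  distrib : ∀ a b → two *ℤ a -ℤ two *ℤ b ≡ two *ℤ (a -ℤ b)
  distrib = solve-∀

dbl+1-doubles : DoublesSteps dbl+1
dbl+1-doubles a b rewrite dbl+1≡ a | dbl+1≡ b = distrib a b
  where
  distrib : ∀ a b → (1ℤ +ℤ two *ℤ a) -ℤ (1ℤ +ℤ two *ℤ b) ≡ two *ℤ (a -ℤ b)
  distrib = solve-∀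

doubled-step-not-val0 : ∀ D → DoublesSteps D → ∀ {x y a b} →
                        x ≡ D a → y ≡ D b → ¬ Val 0 (x -ℤ y)
doubled-step-not-val0 _ hD {a = a} {b} refl refl v = even-not-val0 (subst (Val 0) (hD a b) v)

doubled-step-val : ∀ D → DoublesSteps D → ∀ {t x y a b} →
                   x ≡ D a → y ≡ D b → Val (suc t) (x -ℤ y) → Val t (a -ℤ b)
doubled-step-val _ hD {t} {a = a} {b} refl refl v = even-val-suc (subst (Val (suc t)) (hD a b) v)

crossing-step-not-val-suc : ∀ {t x y a b} → x ≡ dbl+1 a → y ≡ dbl b → ¬ Val (suc t) (x -ℤ y)
crossing-step-not-val-suc {t} {a = a} {b} refl refl v =
  odd-not-val-suc {w = a -ℤ b} (subst (Val (suc t)) (crossing a b) v)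
  where
  crossing : ∀ a b → dbl+1 a -ℤ dbl b ≡ 1ℤ +ℤ two *ℤ (a -ℤ b)
  crossing a b rewrite dbl+1≡ a | dbl≡ b = odd-diff a b
    where
    odd-diff : ∀ a b → (1ℤ +ℤ two *ℤ a) -ℤ two *ℤ b ≡ 1ℤ +ℤ two *ℤ (a -ℤ b)
    odd-diff = solve-∀

-- The boxes [-2^T, 2^T)

Within : ℕ → ℤ → Set
Within T (+ n)    = n < 2 ^ T
Within T -[1+ n ] = n < 2 ^ T

within? : ∀ T x → Dec (Within T x)
within? T (+ n)    = n <? 2 ^ T
within? T -[1+ n ] = n <? 2 ^ T

twice-< : ∀ {n K} → n < K → suc (n + n) < 2 * K
twice-< {n} {K} lt = subst (_≤ 2 * K) (cong suc (NP.+-suc n n))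
  (subst (suc n + suc n ≤_) (cong (λ m → K + m) (sym (NP.+-identityʳ K))) (NP.+-mono-≤ lt lt))

twice-<⁻ : ∀ {n K} → n + n < 2 * K → n < K
twice-<⁻ {n} {K} lt with n <? K
... | yes n<K = n<K
... | no  n≮K = ⊥-elim (NP.<⇒≱ lt (subst (_≤ n + n) (cong (λ m → K + m) (sym (NP.+-identityʳ K)))
                                        (NP.+-mono-≤ K≤n K≤n)))
  where K≤n = NP.≮⇒≥ n≮K

twice-<′ : ∀ {n K} → n < K → n + n < 2 * K
twice-<′ lt = NP.<-trans (NP.n<1+n _) (twice-< lt)

twice-<⁻′ : ∀ {n K} → suc (n + n) < 2 * K → n < K
twice-<⁻′ lt = twice-<⁻ (NP.<-trans (NP.n<1+n _) lt)

within-dbl : ∀ {T} y → Within T y → Within (suc T) (dbl y)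
within-dbl (+ n)    h = twice-<′ h
within-dbl -[1+ n ] h = twice-< h

within-dbl+1 : ∀ {T} y → Within T y → Within (suc T) (dbl+1 y)
within-dbl+1 (+ n)    h = twice-< h
within-dbl+1 -[1+ n ] h = twice-<′ h

within-dbl⁻ : ∀ {T} y → Within (suc T) (dbl y) → Within T y
within-dbl⁻ (+ n)    h = twice-<⁻ h
within-dbl⁻ -[1+ n ] h = twice-<⁻′ h

within-dbl+1⁻ : ∀ {T} y → Within (suc T) (dbl+1 y) → Within T y
within-dbl+1⁻ (+ n)    h = twice-<⁻′ h
within-dbl+1⁻ -[1+ n ] h = twice-<⁻ h

within-mono : ∀ {T T′} x → T ≤ T′ → Within T x → Within T′ x
within-mono (+ n)    le h = NP.<-≤-trans h (NP.^-monoʳ-≤ 2 le)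
within-mono -[1+ n ] le h = NP.<-≤-trans h (NP.^-monoʳ-≤ 2 le)

within⇒∣∣≤ : ∀ {T} x → Within T x → ∣ x ∣ ≤ 2 ^ T
within⇒∣∣≤ (+ n)    h = NP.<⇒≤ h
within⇒∣∣≤ -[1+ n ] h = h

outside⇒≤∣∣ : ∀ {T} x → ¬ Within T x → 2 ^ T ≤ ∣ x ∣
outside⇒≤∣∣ (+ n)    h = NP.≮⇒≥ h
outside⇒≤∣∣ -[1+ n ] h = NP.≤-trans (NP.≮⇒≥ h) (NP.n≤1+n n)

∣∣<⇒within : ∀ {T} x → ∣ x ∣ < 2 ^ T → Within T x
∣∣<⇒within (+ n)    h = h
∣∣<⇒within -[1+ n ] h = NP.<-trans (NP.n<1+n n) h

within-0 : ∀ x → Within 0 x → (x ≡ +0) ⊎ (x ≡ -[1+ 0 ])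
within-0 (+ zero)     _ = inj₁ refl
within-0 (+ suc n)    (s≤s ())
within-0 -[1+ zero ]  _ = inj₂ refl
within-0 -[1+ suc n ] (s≤s ())

n<2^n : ∀ n → n < 2 ^ n
n<2^n zero    = s≤s z≤n
n<2^n (suc n) = begin-strict
    suc n          <⟨ s≤s (n<2^n n) ⟩
    suc (2 ^ n)    ≡⟨ NP.+-comm 1 (2 ^ n) ⟩
    2 ^ n + 1      ≤⟨ NP.+-monoʳ-≤ (2 ^ n) (NP.m^n>0 2 n) ⟩
    2 ^ n + 2 ^ n  ≡⟨ cong (λ m → 2 ^ n + m) (sym (NP.+-identityʳ (2 ^ n))) ⟩
    2 ^ suc n      ∎
  where open NP.≤-Reasoning

-- Step-free lists and the doubling construction

StepFree : (ℕ → ℤ) → ℕ → Set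
StepFree F K = ∀ {p q u t} → p < q → q < u → u < K →
               Val t (F q -ℤ F p) → Val t (F u -ℤ F q) → ⊥

<-≡ : ∀ {a b c} → a < b → b ≡ c → a < c
<-≡ h refl = h

shift-< : ∀ {K p q} → K ≤ p → p < q → p ∸ K < q ∸ K
shift-< K≤p p<q = NP.∸-monoˡ-< p<q K≤p

module Doubling (f : ℕ → ℤ) (N : ℕ) where

  size : ℕ → ℕ
  size a = 2 ^ a * N

  size-0 : size 0 ≡ N
  size-0 = NP.*-identityˡ N

  size-suc : ∀ a → size (suc a) ≡ size a + size a
  size-suc a = trans (NP.*-assoc 2 (2 ^ a) N) (cong (λ m → size a + m) (NP.+-identityʳ (size a)))

  doubled : ℕ → ℕ → ℤ
  doubled zero    p = f p
  doubled (suc a) p with p <? size a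
  ... | yes _ = dbl (doubled a p)
  ... | no  _ = dbl+1 (doubled a (p ∸ size a))

  half : ∀ a p → (p < size a × doubled (suc a) p ≡ dbl (doubled a p))
               ⊎ (size a ≤ p × doubled (suc a) p ≡ dbl+1 (doubled a (p ∸ size a)))
  half a p with p <? size a
  ... | yes p<  = inj₁ (p< , refl)
  ... | no  p≮ = inj₂ (NP.≮⇒≥ p≮ , refl)

  first-half-at : ∀ a {p} → p < size a → doubled (suc a) p ≡ dbl (doubled a p)
  first-half-at a {p} p< with half a p
  ... | inj₁ (_ , e)  = e
  ... | inj₂ (p≥ , _) = ⊥-elim (NP.<⇒≱ p< p≥)

  second-half-at : ∀ a p → doubled (suc a) (p + size a) ≡ dbl+1 (doubled a p)
  second-half-at a p with half a (p + size a)
  ... | inj₁ (p< , _) = ⊥-elim (NP.<⇒≱ p< (NP.m≤n+m (size a) p))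
  ... | inj₂ (_ , e)  = trans e (cong (λ m → dbl+1 (doubled a m)) (NP.m+n∸n≡m p (size a)))

  second-half-< : ∀ a {p} → size a ≤ p → p < size (suc a) → p ∸ size a < size a
  second-half-< a {p} p≥ p< =
    <-≡ (NP.∸-monoˡ-< (<-≡ p< (size-suc a)) p≥) (NP.m+n∸m≡n (size a) (size a))

  -- Positions p < q < u lie in ordered halves; a step
  -- inside one half is even (so valuation 0 is impossible and a positive valuation halves),
  -- a step crossing the halves is odd.
  doubled-stepFree : StepFree f N → ∀ a → StepFree (doubled a) (size a)
  doubled-stepFree h zero p<q q<u u< = h p<q q<u (<-≡ u< size-0)
  doubled-stepFree h (suc a) {p} {q} {u} {t} p<q q<u u< v₁ v₂
    with half a p | half a q | half a u
  ... | inj₂ (p≥ , _) | inj₁ (q< , _) | _ = NP.<-asym p<q (NP.<-≤-trans q< p≥)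
  ... | _ | inj₂ (q≥ , _) | inj₁ (u< , _) = NP.<-asym q<u (NP.<-≤-trans u< q≥)
  doubled-stepFree h (suc a) {t = zero} _ _ _ v₁ v₂ | inj₁ (_ , ep) | inj₁ (_ , eq) | _ =
    doubled-step-not-val0 dbl dbl-doubles eq ep v₁
  doubled-stepFree h (suc a) {t = zero} _ _ _ v₁ v₂ | inj₁ _ | inj₂ (_ , eq) | inj₂ (_ , eu) =
    doubled-step-not-val0 dbl+1 dbl+1-doubles eu eq v₂
  doubled-stepFree h (suc a) {t = zero} _ _ _ v₁ v₂ | inj₂ (_ , ep) | inj₂ (_ , eq) | _ =
    doubled-step-not-val0 dbl+1 dbl+1-doubles eq ep v₁
  doubled-stepFree h (suc a) {t = suc t} p<q q<u _ v₁ v₂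
    | inj₁ (_ , ep) | inj₁ (_ , eq) | inj₁ (u< , eu) =
    doubled-stepFree h a p<q q<u u<
      (doubled-step-val dbl dbl-doubles eq ep v₁) (doubled-step-val dbl dbl-doubles eu eq v₂)
  doubled-stepFree h (suc a) {t = suc t} _ _ _ v₁ v₂ | inj₁ _ | inj₁ (_ , eq) | inj₂ (_ , eu) =
    crossing-step-not-val-suc eu eq v₂
  doubled-stepFree h (suc a) {t = suc t} _ _ _ v₁ v₂ | inj₁ (_ , ep) | inj₂ (_ , eq) | _ =
    crossing-step-not-val-suc eq ep v₁
  doubled-stepFree h (suc a) {t = suc t} p<q q<u u< v₁ v₂
    | inj₂ (p≥ , ep) | inj₂ (q≥ , eq) | inj₂ (u≥ , eu) =
    doubled-stepFree h a (shift-< p≥ p<q) (shift-< q≥ q<u) (second-half-< a u≥ u<)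
      (doubled-step-val dbl+1 dbl+1-doubles eq ep v₁) (doubled-step-val dbl+1 dbl+1-doubles eu eq v₂)

  doubled-injective : (∀ {p q} → p < N → q < N → f p ≡ f q → p ≡ q) →
                      ∀ a {p q} → p < size a → q < size a → doubled a p ≡ doubled a q → p ≡ q
  doubled-injective h zero p< q< e = h (<-≡ p< size-0) (<-≡ q< size-0) e
  doubled-injective h (suc a) {p} {q} p< q< e with half a p | half a q
  ... | inj₁ (p<′ , ep) | inj₁ (q<′ , eq) =
    doubled-injective h a p<′ q<′ (dbl-injective (trans (sym ep) (trans e eq)))
  ... | inj₁ (_ , ep) | inj₂ (_ , eq) = ⊥-elim (dbl≢dbl+1 (trans (sym ep) (trans e eq)))
  ... | inj₂ (_ , ep) | inj₁ (_ , eq) = ⊥-elim (dbl≢dbl+1 (trans (sym eq) (trans (sym e) ep)))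
  ... | inj₂ (p≥ , ep) | inj₂ (q≥ , eq) =
    NP.∸-cancelʳ-≡ p≥ q≥ (doubled-injective h a (second-half-< a p≥ p<) (second-half-< a q≥ q<)
                            (dbl+1-injective (trans (sym ep) (trans e eq))))

  module Image (P : ℕ → ℤ → Set)
               (base : ∀ {p} → p < N → P 0 (f p))
               (step-dbl : ∀ {a y} → P a y → P (suc a) (dbl y))
               (step-dbl+1 : ∀ {a y} → P a y → P (suc a) (dbl+1 y)) where

    doubled-image : ∀ a {p} → p < size a → P a (doubled a p)
    doubled-image zero    p< = base (<-≡ p< size-0)
    doubled-image (suc a) {p} p< with half a p
    ... | inj₁ (p<′ , e) = subst (P (suc a)) (sym e) (step-dbl (doubled-image a p<′))
    ... | inj₂ (p≥ , e)  = subst (P (suc a)) (sym e) (step-dbl+1 (doubled-image a (second-half-< a p≥ p<)))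

  module Onto (P : ℕ → ℤ → Set)
              (base : ∀ {x} → P 0 x → ∃ λ p → p < N × f p ≡ x)
              (split : ∀ {a x} → P (suc a) x → ∃ λ y → P a y × ((x ≡ dbl y) ⊎ (x ≡ dbl+1 y))) where

    doubled-onto : ∀ a {x} → P a x → ∃ λ p → p < size a × doubled a p ≡ x
    doubled-onto zero h with base h
    ... | p , p< , e = p , <-≡ p< (sym size-0) , e
    doubled-onto (suc a) h with split h
    ... | y , hy , which with doubled-onto a hy
    ... | p , p< , refl with which
    ... | inj₁ refl = p , <-≡ (NP.<-≤-trans p< (NP.m≤m+n _ _)) (sym (size-suc a)) , first-half-at a p<
    ... | inj₂ refl = p + size a , <-≡ (NP.+-monoˡ-< (size a) p<) (sym (size-suc a)) , second-half-at a p

box₀ : ℕ → ℤ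
box₀ zero    = +0
box₀ (suc _) = -[1+ 0 ]

module Box = Doubling box₀ 2
open Box using () renaming (doubled to box; size to boxSize)

box-stepFree : ∀ a → StepFree (box a) (boxSize a)
box-stepFree = Box.doubled-stepFree too-short
  where
  too-short : StepFree box₀ 2
  too-short p<q q<u u<2 _ _ = NP.<⇒≱ u<2 (NP.≤-trans (s≤s (NP.≤-trans (s≤s z≤n) p<q)) q<u)

box-injective : ∀ a {p q} → p < boxSize a → q < boxSize a → box a p ≡ box a q → p ≡ q
box-injective = Box.doubled-injective box₀-injective
  where
  box₀-injective : ∀ {p q} → p < 2 → q < 2 → box₀ p ≡ box₀ q → p ≡ q
  box₀-injective {zero}  {zero}  _ _ _ = refl
  box₀-injective {zero}  {suc q} _ _ ()
  box₀-injective {suc p} {zero}  _ _ ()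
  box₀-injective {suc zero} {suc zero} _ _ _ = refl
  box₀-injective {suc (suc p)} (s≤s (s≤s ())) _ _
  box₀-injective {suc zero} {suc (suc q)} _ (s≤s (s≤s ())) _

box-image : ∀ a {p} → p < boxSize a → Within a (box a p)
box-image = Box.Image.doubled-image Within box₀-within (λ {_} {y} → within-dbl y) (λ {_} {y} → within-dbl+1 y)
  where
  box₀-within : ∀ {p} → p < 2 → Within 0 (box₀ p)
  box₀-within {zero}  _ = s≤s z≤n
  box₀-within {suc p} _ = s≤s z≤n

box-onto : ∀ a {x} → Within a x → ∃ λ p → p < boxSize a × box a p ≡ x
box-onto = Box.Onto.doubled-onto Within box₀-onto split
  where
  box₀-onto : ∀ {x} → Within 0 x → ∃ λ p → p < 2 × box₀ p ≡ x
  box₀-onto {x} h with within-0 x h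
  ... | inj₁ refl = 0 , s≤s z≤n , refl
  ... | inj₂ refl = 1 , s≤s (s≤s z≤n) , refl
  split : ∀ {a x} → Within (suc a) x → ∃ λ y → Within a y × ((x ≡ dbl y) ⊎ (x ≡ dbl+1 y))
  split {a} {x} h with halve x
  ... | y , inj₁ refl = y , within-dbl⁻ y h , inj₁ refl
  ... | y , inj₂ refl = y , within-dbl+1⁻ y h , inj₂ refl

boxSize≥2 : ∀ a → 2 ≤ boxSize a
boxSize≥2 zero    = s≤s (s≤s z≤n)
boxSize≥2 (suc a) = subst (2 ≤_) (sym (Box.size-suc a)) (NP.≤-trans (boxSize≥2 a) (NP.m≤m+n _ _))

box-first : ∀ a → box a 0 ≡ +0
box-first zero    = refl
box-first (suc a) = trans (Box.first-half-at a (NP.<-≤-trans (s≤s z≤n) (boxSize≥2 a)))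
                          (cong dbl (box-first a))

box-last : ∀ a → box a (boxSize a ∸ 1) ≡ -[1+ 0 ]
box-last zero    = refl
box-last (suc a) = begin
    box (suc a) (boxSize (suc a) ∸ 1)       ≡⟨ cong (box (suc a)) last-position ⟩
    box (suc a) ((boxSize a ∸ 1) + boxSize a) ≡⟨ Box.second-half-at a (boxSize a ∸ 1) ⟩
    dbl+1 (box a (boxSize a ∸ 1))            ≡⟨ cong dbl+1 (box-last a) ⟩
    -[1+ 0 ]                                  ∎
  where
  open ≡-Reasoning
  last-position : boxSize (suc a) ∸ 1 ≡ (boxSize a ∸ 1) + boxSize a
  last-position = trans (cong (_∸ 1) (Box.size-suc a))
                        (NP.+-∸-comm (boxSize a) (NP.≤-trans (s≤s z≤n) (boxSize≥2 a)))

InAnnulus : ℕ → ℕ → ℤ → Set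
InAnnulus g a x = Within (a + g) x × ¬ Within a x

-- Removing the first and last entries 0 and -1 from the box listing of exponent g lists
-- the annulus with a = 0; doubling that list a times lists the annulus with inner exponent a.
module Annulus (g : ℕ) where

  innerSize : ℕ
  innerSize = boxSize g ∸ 2

  inner : ℕ → ℤ
  inner u = box g (suc u)

  boxSize≡ : boxSize g ≡ suc (suc innerSize)
  boxSize≡ = sym (NP.m+[n∸m]≡n (boxSize≥2 g))

  last-position : boxSize g ∸ 1 ≡ suc innerSize
  last-position = cong (_∸ 1) boxSize≡

  inner-position : ∀ {u} → u < innerSize → suc u < boxSize g
  inner-position {u} u< = subst (suc u <_) (sym boxSize≡) (s≤s (NP.<-trans u< (NP.n<1+n innerSize)))

  inner-stepFree : StepFree inner innerSize
  inner-stepFree p<q q<u u< = box-stepFree g (s≤s p<q) (s≤s q<u) (inner-position u<)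

  inner-injective : ∀ {p q} → p < innerSize → q < innerSize → inner p ≡ inner q → p ≡ q
  inner-injective p< q< e = NP.suc-injective (box-injective g (inner-position p<) (inner-position q<) e)

  corner-positions : ∀ {p} → p < boxSize g → Within 0 (box g p) → (p ≡ 0) ⊎ (p ≡ suc innerSize)
  corner-positions {p} p< h with within-0 (box g p) h
  ... | inj₁ e = inj₁ (box-injective g p< first< (trans e (sym (box-first g))))
    where first< = NP.<-≤-trans (s≤s z≤n) (boxSize≥2 g)
  ... | inj₂ e = inj₂ (trans (box-injective g p< last< (trans e (sym (box-last g)))) last-position)
    where last< = subst₂ _<_ (sym last-position) (sym boxSize≡) (NP.n<1+n _)

  inner-image : ∀ {u} → u < innerSize → InAnnulus g 0 (inner u)
  inner-image {u} u< = box-image g (inner-position u<) , not-centre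
    where
    not-centre : ¬ Within 0 (inner u)
    not-centre h with corner-positions (inner-position u<) h
    ... | inj₁ ()
    ... | inj₂ u≡ = NP.<-irrefl (NP.suc-injective u≡) u<

  inner-onto : ∀ {x} → InAnnulus g 0 x → ∃ λ u → u < innerSize × inner u ≡ x
  inner-onto {x} (inBox , notCentre) with box-onto g inBox
  ... | zero , _ , e = ⊥-elim (notCentre (subst (Within 0) (trans (sym (box-first g)) e) (s≤s z≤n)))
  ... | suc u , p< , e with u <? innerSize
  ...   | yes u< = u , u< , e
  ...   | no  u≮ = ⊥-elim (notCentre (subst (Within 0) at-last (s≤s z≤n)))
    where
    u≡ : u ≡ innerSize
    u≡ = NP.≤-antisym (NP.≤-pred (NP.≤-pred (subst (suc (suc u) ≤_) boxSize≡ p<))) (NP.≮⇒≥ u≮)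
    at-last : -[1+ 0 ] ≡ x
    at-last = trans (sym (box-last g)) (trans (cong (box g) (trans last-position (cong suc (sym u≡)))) e)

  module Ann = Doubling inner innerSize
  open Ann public using () renaming (doubled to annulus; size to annulusSize)

  annulus-stepFree : ∀ a → StepFree (annulus a) (annulusSize a)
  annulus-stepFree = Ann.doubled-stepFree inner-stepFree

  annulus-injective : ∀ a {p q} → p < annulusSize a → q < annulusSize a →
                      annulus a p ≡ annulus a q → p ≡ q
  annulus-injective = Ann.doubled-injective inner-injective

  annulus-image : ∀ a {p} → p < annulusSize a → InAnnulus g a (annulus a p)
  annulus-image = Ann.Image.doubled-image (InAnnulus g) inner-image
    (λ {_} {y} (inBox , notIn) → within-dbl y inBox , λ h → notIn (within-dbl⁻ y h))
    (λ {_} {y} (inBox , notIn) → within-dbl+1 y inBox , λ h → notIn (within-dbl+1⁻ y h))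

  annulus-onto : ∀ a {x} → InAnnulus g a x → ∃ λ p → p < annulusSize a × annulus a p ≡ x
  annulus-onto = Ann.Onto.doubled-onto (InAnnulus g) inner-onto split
    where
    split : ∀ {a x} → InAnnulus g (suc a) x →
            ∃ λ y → InAnnulus g a y × ((x ≡ dbl y) ⊎ (x ≡ dbl+1 y))
    split {a} {x} (inBox , notIn) with halve x
    ... | y , inj₁ refl = y , (within-dbl⁻ y inBox , λ h → notIn (within-dbl y h)) , inj₁ refl
    ... | y , inj₂ refl = y , (within-dbl+1⁻ y inBox , λ h → notIn (within-dbl+1 y h)) , inj₂ refl

  annulusSize-pos : 1 ≤ g → ∀ a → 0 < annulusSize a
  annulusSize-pos g≥1 a = NP.*-mono-≤ (NP.m^n>0 2 a) innerSize-pos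
    where
    innerSize-pos : 1 ≤ innerSize
    innerSize-pos = NP.≤-trans (s≤s z≤n) (NP.∸-monoˡ-≤ 2 (NP.*-monoˡ-≤ 2 (NP.^-monoʳ-≤ 2 g≥1)))

-- The permutation: a box followed by annuli of growing radius

stepwise-mono : (f : ℕ → ℕ) → (∀ n → f n ≤ f (suc n)) → ∀ {m n} → m ≤ n → f m ≤ f n
stepwise-mono f step m≤n = go (NP.≤⇒≤′ m≤n)
  where
  go : ∀ {m n} → m N.≤′ n → f m ≤ f n
  go N.≤′-refl     = NP.≤-refl
  go (N.≤′-step p) = NP.≤-trans (go p) (step _)

module Blocks (k : ℕ) where

  g : ℕ
  g = suc k

  open Annulus g

  radius : ℕ → ℕ
  radius zero    = k
  radius (suc n) = radius n + g

  blockEnd : ℕ → ℕ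
  blockEnd zero    = boxSize k
  blockEnd (suc n) = blockEnd n + annulusSize (radius n)

  data InBlock : ℕ → ℕ → Set where
    block₀ : ∀ {m} → m < blockEnd 0 → InBlock 0 m
    blockₛ : ∀ {n m} → blockEnd n ≤ m → m < blockEnd (suc n) → InBlock (suc n) m

  data InLayer : ℕ → ℤ → Set where
    layer₀ : ∀ {x} → Within k x → InLayer 0 x
    layerₛ : ∀ {n x} → InAnnulus g (radius n) x → InLayer (suc n) x

  blockEntry : ℕ → ℕ → ℤ
  blockEntry zero    m = box k m
  blockEntry (suc n) m = annulus (radius n) (m ∸ blockEnd n)

  blockEnd-< : ∀ n → blockEnd n < blockEnd (suc n)
  blockEnd-< n = NP.m<m+n (blockEnd n) (annulusSize-pos (s≤s z≤n) (radius n))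

  blockEnd-mono : ∀ {m n} → m ≤ n → blockEnd m ≤ blockEnd n
  blockEnd-mono = stepwise-mono blockEnd (λ n → NP.<⇒≤ (blockEnd-< n))

  n<blockEnd : ∀ n → n < blockEnd n
  n<blockEnd zero    = NP.<-≤-trans (s≤s z≤n) (boxSize≥2 k)
  n<blockEnd (suc n) = NP.≤-trans (s≤s (n<blockEnd n)) (blockEnd-< n)

  block-exists : ∀ m → ∃ λ n → InBlock n m
  block-exists m = search m (n<blockEnd m)
    where
    search : ∀ n → m < blockEnd n → ∃ λ j → InBlock j m
    search zero    m< = 0 , block₀ m<
    search (suc n) m< with m <? blockEnd n
    ... | yes m<′ = search n m<′
    ... | no  m≮  = suc n , blockₛ (NP.≮⇒≥ m≮) m<

  InBlock⇒< : ∀ {n m} → InBlock n m → m < blockEnd n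
  InBlock⇒< (block₀ m<)   = m<
  InBlock⇒< (blockₛ _ m<) = m<

  InBlock-mono : ∀ {n n′ i j} → i ≤ j → InBlock n i → InBlock n′ j → n ≤ n′
  InBlock-mono {n} {n′} i≤j bi bj with n N.≤? n′
  ... | yes n≤n′ = n≤n′
  ... | no  n≰n′ with n | bi | NP.≰⇒> n≰n′
  ... | suc n₀ | blockₛ i≥ _ | s≤s n′≤n₀ =
    ⊥-elim (NP.<⇒≱ (InBlock⇒< bj) (NP.≤-trans (blockEnd-mono n′≤n₀) (NP.≤-trans i≥ i≤j)))

  InBlock-unique : ∀ {n n′ m} → InBlock n m → InBlock n′ m → n ≡ n′
  InBlock-unique b b′ = NP.≤-antisym (InBlock-mono NP.≤-refl b b′) (InBlock-mono NP.≤-refl b′ b)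

  radius-mono : ∀ {m n} → m ≤ n → radius m ≤ radius n
  radius-mono = stepwise-mono radius (λ n → NP.m≤m+n (radius n) g)

  n≤radius : ∀ n → n ≤ radius n
  n≤radius zero    = z≤n
  n≤radius (suc n) = subst (_≤ radius n + g) (NP.+-comm n 1) (NP.+-mono-≤ (n≤radius n) (s≤s z≤n))

  InLayer⇒within : ∀ {n x} → InLayer n x → Within (radius n) x
  InLayer⇒within (layer₀ h)       = h
  InLayer⇒within (layerₛ (h , _)) = h

  InLayer-mono : ∀ {n n′ x} → InLayer n x → InLayer n′ x → n ≤ n′
  InLayer-mono {n} {n′} {x} h h′ with n N.≤? n′
  ... | yes n≤n′ = n≤n′
  ... | no  n≰n′ with n | h | NP.≰⇒> n≰n′
  ... | suc n₀ | layerₛ (_ , outside) | s≤s n′≤n₀ =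
    ⊥-elim (outside (within-mono x (radius-mono n′≤n₀) (InLayer⇒within h′)))

  InLayer-unique : ∀ {n n′ x} → InLayer n x → InLayer n′ x → n ≡ n′
  InLayer-unique h h′ = NP.≤-antisym (InLayer-mono h h′) (InLayer-mono h′ h)

  layer-exists : ∀ x → ∃ λ n → InLayer n x
  layer-exists x = search ∣ x ∣ (∣∣<⇒within x (NP.<-≤-trans (n<2^n ∣ x ∣) (NP.^-monoʳ-≤ 2 (n≤radius ∣ x ∣))))
    where
    search : ∀ n → Within (radius n) x → ∃ λ j → InLayer j x
    search zero    h = 0 , layer₀ h
    search (suc n) h with within? (radius n) x
    ... | yes h′  = search n h′
    ... | no  h′-fails = suc n , layerₛ (h , h′-fails)

  offset-< : ∀ {n m} → blockEnd n ≤ m → m < blockEnd (suc n) → m ∸ blockEnd n < annulusSize (radius n)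
  offset-< {n} m≥ m< = <-≡ (NP.∸-monoˡ-< m< m≥) (NP.m+n∸m≡n (blockEnd n) (annulusSize (radius n)))

  blockEntry-layer : ∀ {n m} → InBlock n m → InLayer n (blockEntry n m)
  blockEntry-layer (block₀ m<)        = layer₀ (box-image k m<)
  blockEntry-layer (blockₛ {n} m≥ m<) = layerₛ (annulus-image (radius n) (offset-< {n} m≥ m<))

  layer-onto : ∀ {n x} → InLayer n x → ∃ λ m → InBlock n m × blockEntry n m ≡ x
  layer-onto (layer₀ h) with box-onto k h
  ... | p , p< , e = p , block₀ p< , e
  layer-onto {suc n} (layerₛ h) with annulus-onto (radius n) h
  ... | p , p< , e = blockEnd n + p ,
                     blockₛ (NP.m≤m+n (blockEnd n) p) (NP.+-monoʳ-< (blockEnd n) p<) ,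
                     trans (cong (annulus (radius n)) (NP.m+n∸m≡n (blockEnd n) p)) e

  blockEntry-injective : ∀ {n m m′} → InBlock n m → InBlock n m′ → blockEntry n m ≡ blockEntry n m′ → m ≡ m′
  blockEntry-injective (block₀ m<) (block₀ m′<) e = box-injective k m< m′< e
  blockEntry-injective {suc n} (blockₛ m≥ m<) (blockₛ m′≥ m′<) e =
    NP.∸-cancelʳ-≡ m≥ m′≥ (annulus-injective (radius n) (offset-< {n} m≥ m<) (offset-< {n} m′≥ m′<) e)

  blockEntry-stepFree : ∀ {n p q u t} → InBlock n p → InBlock n q → InBlock n u → p < q → q < u →
                        Val t (blockEntry n q -ℤ blockEntry n p) → Val t (blockEntry n u -ℤ blockEntry n q) → ⊥
  blockEntry-stepFree (block₀ _) (block₀ _) (block₀ u<) p<q q<u = box-stepFree k p<q q<u u<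
  blockEntry-stepFree {suc n} (blockₛ p≥ _) (blockₛ q≥ _) (blockₛ u≥ u<) p<q q<u =
    annulus-stepFree (radius n) (shift-< p≥ p<q) (shift-< q≥ q<u) (offset-< {n} u≥ u<)

  blockOf : ℕ → ℕ
  blockOf m = proj₁ (block-exists m)

  inBlockOf : ∀ m → InBlock (blockOf m) m
  inBlockOf m = proj₂ (block-exists m)

  listing : ℕ → ℤ
  listing m = blockEntry (blockOf m) m

  listing-in-block : ∀ {n m} → InBlock n m → listing m ≡ blockEntry n m
  listing-in-block {n} {m} b with InBlock-unique (inBlockOf m) b
  ... | refl = refl

  listing-layer : ∀ m → InLayer (blockOf m) (listing m)
  listing-layer m = blockEntry-layer (inBlockOf m)

  blockOf-mono : ∀ {i j} → i ≤ j → blockOf i ≤ blockOf j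
  blockOf-mono i≤j = InBlock-mono i≤j (inBlockOf _) (inBlockOf _)

  listing-injective : ∀ i j → listing i ≡ listing j → i ≡ j
  listing-injective i j e = blockEntry-injective (inBlockOf i) j-in-i's-block
      (trans (sym (listing-in-block (inBlockOf i))) (trans e (listing-in-block j-in-i's-block)))
    where
    same-layer : blockOf j ≡ blockOf i
    same-layer = InLayer-unique (listing-layer j) (subst (InLayer (blockOf i)) e (listing-layer i))
    j-in-i's-block : InBlock (blockOf i) j
    j-in-i's-block = subst (λ n → InBlock n j) same-layer (inBlockOf j)

  listing-onto : ∀ x → ∃ λ i → listing i ≡ x
  listing-onto x with layer-exists x
  ... | n , h with layer-onto h
  ... | m , b , e = m , trans (listing-in-block b) e

  permutation : PermutationOfℤ
  permutation = record { seq = listing ; injective = listing-injective ; surjective = listing-onto }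

  listing-stepFree : ∀ {p q u t} → p < q → q < u → blockOf p ≡ blockOf u →
                     Val t (listing q -ℤ listing p) → Val t (listing u -ℤ listing q) → ⊥
  listing-stepFree {p} {q} {u} {t} p<q q<u same v₁ v₂ =
    blockEntry-stepFree bp bq bu p<q q<u
      (subst₂ (λ X Y → Val t (X -ℤ Y)) (listing-in-block bq) (listing-in-block bp) v₁)
      (subst₂ (λ X Y → Val t (X -ℤ Y)) (listing-in-block bu) (listing-in-block bq) v₂)
    where
    bp = inBlockOf p
    q-same : blockOf q ≡ blockOf p
    q-same = NP.≤-antisym (NP.≤-trans (blockOf-mono (NP.<⇒≤ q<u)) (NP.≤-reflexive (sym same)))
                          (blockOf-mono (NP.<⇒≤ p<q))
    bq = subst (λ n → InBlock n q) q-same (inBlockOf q)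
    bu = subst (λ n → InBlock n u) (sym same) (inBlockOf u)

  layer-growth : ∀ {n n′ x y} → InLayer n x → InLayer n′ y → suc (suc n) ≤ n′ → 2 ^ g * ∣ x ∣ ≤ ∣ y ∣
  layer-growth {n} {suc n₀} {x} {y} hx (layerₛ (_ , outside)) (s≤s n<n₀) = begin
      2 ^ g * ∣ x ∣           ≤⟨ NP.*-monoʳ-≤ (2 ^ g) (within⇒∣∣≤ x (InLayer⇒within hx)) ⟩
      2 ^ g * 2 ^ radius n    ≡⟨ NP.*-comm (2 ^ g) (2 ^ radius n) ⟩
      2 ^ radius n * 2 ^ g    ≡⟨ sym (NP.^-distribˡ-+-* 2 (radius n) g) ⟩
      2 ^ radius (suc n)      ≤⟨ outside⇒≤∣∣ y (λ h → outside (within-mono y (radius-mono n<n₀) h)) ⟩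
      ∣ y ∣                   ∎
    where open NP.≤-Reasoning

  equal-steps-cross-blocks : ∀ {i j l t} → i < j → j < l →
                             Val t (listing j -ℤ listing i) → Val t (listing l -ℤ listing j) →
                             blockOf i < blockOf l
  equal-steps-cross-blocks {i} {j} {l} i<j j<l v₁ v₂ with blockOf i <? blockOf l
  ... | yes i<l = i<l
  ... | no  i≮l = ⊥-elim (listing-stepFree i<j j<l same-block v₁ v₂)
    where
    same-block : blockOf i ≡ blockOf l
    same-block = NP.≤-antisym (blockOf-mono (NP.<⇒≤ (NP.<-trans i<j j<l))) (NP.≮⇒≥ i≮l)

-- Avoiding progressions whose ratios are all odd

squeezed : ∀ X a Y B G → a ≤ X + X → Y ≤ X + B * a → G * X ≤ Y → suc (suc (B + B)) ≤ G → a ≡ 0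
squeezed X a Y B G a≤ Y≤ GX≤Y G≥ = NP.n≤0⇒n≡0 (subst (λ z → a ≤ z + z) X≡0 a≤)
  where
  chain : (X + B * (X + X)) + X ≤ (X + B * (X + X)) + 0
  chain = begin
      (X + B * (X + X)) + X  ≡⟨ regroup X B ⟩
      suc (suc (B + B)) * X  ≤⟨ NP.*-monoˡ-≤ X G≥ ⟩
      G * X                  ≤⟨ NP.≤-trans GX≤Y Y≤ ⟩
      X + B * a              ≤⟨ NP.+-monoʳ-≤ X (NP.*-monoʳ-≤ B a≤) ⟩
      X + B * (X + X)        ≡⟨ sym (NP.+-identityʳ _) ⟩
      (X + B * (X + X)) + 0  ∎
    where
    open NP.≤-Reasoning
    regroup : ∀ X B → (X + B * (X + X)) + X ≡ suc (suc (B + B)) * X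
    regroup = ℕ-solve
  X≡0 : X ≡ 0
  X≡0 = NP.n≤0⇒n≡0 (NP.+-cancelˡ-≤ (X + B * (X + X)) X 0 chain)

step-bound : ∀ x y B d → y -ℤ x ≡ + B *ℤ d → ∣ y ∣ ≤ ∣ x ∣ + B * ∣ d ∣
step-bound x y B d e = begin
    ∣ y ∣                     ≡⟨ cong ∣_∣ (split x y) ⟩
    ∣ x +ℤ (y -ℤ x) ∣         ≤⟨ ZP.∣i+j∣≤∣i∣+∣j∣ x (y -ℤ x) ⟩
    ∣ x ∣ + ∣ y -ℤ x ∣        ≡⟨ cong (λ z → ∣ x ∣ + ∣ z ∣) e ⟩
    ∣ x ∣ + ∣ + B *ℤ d ∣      ≡⟨ cong (λ z → ∣ x ∣ + z) (ZP.abs-* (+ B) d) ⟩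
    ∣ x ∣ + B * ∣ d ∣         ∎
  where
  open NP.≤-Reasoning
  split : ∀ x y → y ≡ x +ℤ (y -ℤ x)
  split = solve-∀

four-steps : ∀ x₁ x₂ x₃ x₄ x₅ R₁ R₂ R₃ R₄ d →
             x₂ -ℤ x₁ ≡ + R₁ *ℤ d → x₃ -ℤ x₂ ≡ + R₂ *ℤ d → x₄ -ℤ x₃ ≡ + R₃ *ℤ d → x₅ -ℤ x₄ ≡ + R₄ *ℤ d →
             x₅ -ℤ x₁ ≡ + (R₁ + (R₂ + (R₃ + R₄))) *ℤ d
four-steps x₁ x₂ x₃ x₄ x₅ R₁ R₂ R₃ R₄ d e₁ e₂ e₃ e₄ = begin
    x₅ -ℤ x₁
      ≡⟨ telescope x₁ x₂ x₃ x₄ x₅ ⟩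
    (x₂ -ℤ x₁) +ℤ ((x₃ -ℤ x₂) +ℤ ((x₄ -ℤ x₃) +ℤ (x₅ -ℤ x₄)))
      ≡⟨ cong₂ _+ℤ_ e₁ (cong₂ _+ℤ_ e₂ (cong₂ _+ℤ_ e₃ e₄)) ⟩
    + R₁ *ℤ d +ℤ (+ R₂ *ℤ d +ℤ (+ R₃ *ℤ d +ℤ + R₄ *ℤ d))
      ≡⟨ collect (+ R₁) (+ R₂) (+ R₃) (+ R₄) d ⟩
    (+ R₁ +ℤ (+ R₂ +ℤ (+ R₃ +ℤ + R₄))) *ℤ d
      ≡⟨ cong (_*ℤ d) (sym (trans (ZP.pos-+ R₁ _) (cong (+ R₁ +ℤ_)
                              (trans (ZP.pos-+ R₂ _) (cong (+ R₂ +ℤ_) (ZP.pos-+ R₃ R₄)))))) ⟩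
    + (R₁ + (R₂ + (R₃ + R₄))) *ℤ d ∎
  where
  open ≡-Reasoning
  telescope : ∀ x₁ x₂ x₃ x₄ x₅ →
              x₅ -ℤ x₁ ≡ (x₂ -ℤ x₁) +ℤ ((x₃ -ℤ x₂) +ℤ ((x₄ -ℤ x₃) +ℤ (x₅ -ℤ x₄)))
  telescope = solve-∀
  collect : ∀ a b c e d → a *ℤ d +ℤ (b *ℤ d +ℤ (c *ℤ d +ℤ e *ℤ d)) ≡ (a +ℤ (b +ℤ (c +ℤ e))) *ℤ d
  collect = solve-∀

-- With odd ratios every step of a progression has the valuation of d, so x₁, x₃, x₅ and
-- x₂, x₄, x₆ lie in strictly increasing blocks of the listing with g = 2C + 1,
-- C = R₁ + ⋯ + R₅.  Then |x₅| ≥ 2^g|x₁| and |x₆| ≥ 2^g|x₂| squeeze d to 0.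
odd-ratios-avoidable : ∀ R₁ R₂ R₃ R₄ R₅ → Odd R₁ → Odd R₂ → Odd R₃ → Odd R₄ → Odd R₅ →
                       ∃[ p ] Avoids p R₁ R₂ R₃ R₄ R₅
odd-ratios-avoidable R₁ R₂ R₃ R₄ R₅ o₁ o₂ o₃ o₄ o₅ = permutation , avoids
  where
  C : ℕ
  C = R₁ + (R₂ + (R₃ + (R₄ + R₅)))
  open Blocks (C + C)

  growth-suffices : ∀ {B} → B ≤ C → suc (suc (B + B)) ≤ 2 ^ g
  growth-suffices B≤C = NP.≤-trans (s≤s (s≤s (NP.+-mono-≤ B≤C B≤C))) (n<2^n g)

  avoids : Avoids permutation R₁ R₂ R₃ R₄ R₅
  avoids (i₁ , i₂ , i₃ , i₄ , i₅ , i₆ , i₁<i₂ , i₂<i₃ , i₃<i₄ , i₄<i₅ , i₅<i₆ ,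
          d , d≢0 , e₁ , e₂ , e₃ , e₄ , e₅) with val-exists d d≢0
  ... | t , ν-d = d≢0 (ZP.∣i∣≡0⇒i≡0 ∣d∣≡0)
    where
    x₁ = listing i₁
    x₂ = listing i₂
    x₃ = listing i₃
    x₄ = listing i₄
    x₅ = listing i₅
    x₆ = listing i₆
    v₁ = subst (Val t) (sym e₁) (val-odd-* o₁ ν-d)
    v₂ = subst (Val t) (sym e₂) (val-odd-* o₂ ν-d)
    v₃ = subst (Val t) (sym e₃) (val-odd-* o₃ ν-d)
    v₄ = subst (Val t) (sym e₄) (val-odd-* o₄ ν-d)
    v₅ = subst (Val t) (sym e₅) (val-odd-* o₅ ν-d)
    grows₁₅ : 2 ^ g * ∣ x₁ ∣ ≤ ∣ x₅ ∣
    grows₁₅ = layer-growth (listing-layer i₁) (listing-layer i₅)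
      (NP.≤-trans (s≤s (equal-steps-cross-blocks i₁<i₂ i₂<i₃ v₁ v₂))
                  (equal-steps-cross-blocks i₃<i₄ i₄<i₅ v₃ v₄))
    grows₂₆ : 2 ^ g * ∣ x₂ ∣ ≤ ∣ x₆ ∣
    grows₂₆ = layer-growth (listing-layer i₂) (listing-layer i₆)
      (NP.≤-trans (s≤s (equal-steps-cross-blocks i₂<i₃ i₃<i₄ v₂ v₃))
                  (equal-steps-cross-blocks i₄<i₅ i₅<i₆ v₄ v₅))
    ∣d∣≤ : ∣ d ∣ ≤ ∣ x₂ ∣ + ∣ x₁ ∣
    ∣d∣≤ = NP.≤-trans (odd-≤-* o₁ ∣ d ∣)
             (subst (_≤ ∣ x₂ ∣ + ∣ x₁ ∣) (trans (cong ∣_∣ e₁) (ZP.abs-* (+ R₁) d)) (ZP.∣i-j∣≤∣i∣+∣j∣ x₂ x₁))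
    B₁₅ = R₁ + (R₂ + (R₃ + R₄))
    B₂₆ = R₂ + (R₃ + (R₄ + R₅))
    bound₁₅ : ∣ x₅ ∣ ≤ ∣ x₁ ∣ + B₁₅ * ∣ d ∣
    bound₁₅ = step-bound x₁ x₅ B₁₅ d (four-steps x₁ x₂ x₃ x₄ x₅ R₁ R₂ R₃ R₄ d e₁ e₂ e₃ e₄)
    bound₂₆ : ∣ x₆ ∣ ≤ ∣ x₂ ∣ + B₂₆ * ∣ d ∣
    bound₂₆ = step-bound x₂ x₆ B₂₆ d (four-steps x₂ x₃ x₄ x₅ x₆ R₂ R₃ R₄ R₅ d e₂ e₃ e₄ e₅)
    B₁₅≤C : B₁₅ ≤ C
    B₁₅≤C = NP.+-monoʳ-≤ R₁ (NP.+-monoʳ-≤ R₂ (NP.+-monoʳ-≤ R₃ (NP.m≤m+n R₄ R₅)))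
    B₂₆≤C : B₂₆ ≤ C
    B₂₆≤C = NP.m≤n+m B₂₆ R₁
    -- Squeeze along whichever of x₁, x₂ is larger in absolute value.
    ∣d∣≡0 : ∣ d ∣ ≡ 0
    ∣d∣≡0 with NP.≤-total ∣ x₂ ∣ ∣ x₁ ∣
    ... | inj₁ x₂≤x₁ = squeezed (∣ x₁ ∣) (∣ d ∣) (∣ x₅ ∣) B₁₅ (2 ^ g)
          (NP.≤-trans ∣d∣≤ (NP.+-monoˡ-≤ ∣ x₁ ∣ x₂≤x₁)) bound₁₅ grows₁₅ (growth-suffices B₁₅≤C)
    ... | inj₂ x₁≤x₂ = squeezed (∣ x₂ ∣) (∣ d ∣) (∣ x₆ ∣) B₂₆ (2 ^ g)
          (NP.≤-trans ∣d∣≤ (NP.+-monoʳ-≤ ∣ x₂ ∣ x₁≤x₂)) bound₂₆ grows₂₆ (growth-suffices B₂₆≤C)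

mainTheorem13 : (r s : ℕ) → .{{_ : NonZero r}} → .{{_ : NonZero s}}
    → r % 2 ≡ 1 → s % 2 ≡ 1
    → ∃[ p ] Avoids p (r ^ 4) (r ^ 3 * s) (r ^ 2 * s ^ 2) (r * s ^ 3) (s ^ 4)
mainTheorem13 r s r-odd s-odd =
  odd-ratios-avoidable (r ^ 4) (r ^ 3 * s) (r ^ 2 * s ^ 2) (r * s ^ 3) (s ^ 4)
    (odd-^ 4 or) (odd-* (odd-^ 3 or) os) (odd-* (odd-^ 2 or) (odd-^ 2 os))
    (odd-* or (odd-^ 3 os)) (odd-^ 4 os)
  where
  or : Odd r
  or = odd r-odd
  os : Odd s
  os = odd s-odd
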